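{- Let $D^2$ be the closed unit disk centered at the origin of $\mathbb R^2$ and let $P_0,P_1,P_2,\dots$ be the sequence of unimodular polygons circumscribing $D^2$ defined below. Let $a,b,c,d\in\mathbb Z_{\geq 0}$ with $ad-bc=1$, such that $(a,b)$ and $(c,d)$ belong to the same quadrant. Then there exists $n\geq 0$ such that $P_n$ has a corner supported by the primitive vectors $(a,b)$ and $(c,d)$, i.e. a vertex at which the two sides of $P_n$ meeting there have outward normal primitive vectors $(a,b)$ and $(c,d)$. Moreover, in passing to $P_{n+1}$ this corner is cropped by the line orthogonal to $(a+c,b+d)$ and tangent to $D^2$.
   Context: A vector in $\mathbb Z^2$ is primitive if its coordinates are coprime. A polygon $P\subset\mathbb R^2$ is unimodular if its sides have rational slopes and, for every pair of adjacent sides, the two primitive vectors in the directions of these sides form a basis of $\mathbb Z^2$. Let $P_0=[-1,1]^2$, in which $D^2$ is inscribed. For $n\geq 0$, $P_{n+1}$ is the polygon obtained from $P_n$ by cutting all of its corners by lines tangent to $D^2$ in such a way that $P_{n+1}$ is a unimodular polygon (this determines $P_{n+1}$ uniquely). Equivalently: if $v_1,v_2$ are the outward primitive normal vectors of the two sides of $P_n$ at a corner, that corner is cut by the tangent line to $D^2$ orthogonal to $v_1+v_2$, i.e. $P_n=\{p: w\cdot p\leq |w|\ \forall w\in W_n\}$ where $W_0=\{(\pm1,0),(0,\pm1)\}$ and $W_{n+1}$ is obtained from $W_n$ by adding $v_1+v_2$ for every pair $v_1,v_2$ of angularly consecutive vectors of $W_n$. -}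

module Defs where

open import Data.Integer using (ℤ; +_; -[1+_]; _+_)
open import Data.List using (List; []; _∷_; _++_; [_])
open import Data.Nat using (ℕ; zero; suc)
open import Data.Product using (_×_; _,_; ∃; ∃-syntax)
open import Data.Sum using (_⊎_)
open import Relation.Binary.PropositionalEquality using (_≡_)

Vec2 : Set
Vec2 = ℤ × ℤ

_⊕_ : Vec2 → Vec2 → Vec2
(a , b) ⊕ (c , d) = (a + c , b + d)

-- The set W_n of outward primitive normals of the sides of P_n, listed in
-- counterclockwise angular order starting from (1,0); the list is read cyclically
-- (its last element is angularly followed by its first).
W₀ : List Vec2
W₀ = (+ 1 , + 0) ∷ (+ 0 , + 1) ∷ (-[1+ 0 ] , + 0) ∷ (+ 0 , -[1+ 0 ]) ∷ []

-- insert x ⊕ y between each pair of consecutive x , y ; the last element is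
-- followed (cyclically) by `first`.
refineFrom : Vec2 → List Vec2 → List Vec2
refineFrom first [] = []
refineFrom first (x ∷ []) = x ∷ (x ⊕ first) ∷ []
refineFrom first (x ∷ y ∷ rest) = x ∷ (x ⊕ y) ∷ refineFrom first (y ∷ rest)

refine : List Vec2 → List Vec2
refine [] = []
refine (x ∷ rest) = refineFrom x (x ∷ rest)

W : ℕ → List Vec2
W zero = W₀
W (suc n) = refine (W n)

CycConsec : List Vec2 → Vec2 → Vec2 → Set
CycConsec L u v =
  (∃[ xs ] ∃[ ys ] L ≡ xs ++ (u ∷ v ∷ ys)) ⊎ (∃[ m ] L ≡ v ∷ (m ++ [ u ]))

-- The polygon P = {p : w·p ≤ |w|, w ∈ L} (all sides tangent to D²) has a corner
-- supported by u and v: u and v are the outward normals of two adjacent sides,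
-- i.e. angularly consecutive in L.
Corner : List Vec2 → Vec2 → Vec2 → Set
Corner L u v = CycConsec L u v ⊎ CycConsec L v u

module Submission where

-- Every unimodular pair of nonnegative primitive vectors (a,b), (c,d) is a node
-- of the Stern–Brocot tree, and the refinement W n ↦ W (suc n) grows exactly that
-- tree; the theorem follows from these two facts.
--
-- If u, v are cyclically consecutive
--    in L, then refine L contains u, u ⊕ v, v consecutively. So a corner of P_n
--    supported by u, v is cut by the side with normal u ⊕ v, producing the two
--    corners (u, u ⊕ v) and (u ⊕ v, v) of P_(n+1).
-- 2. The Stern–Brocot tree: the inductive family generated from the root pair
--    ((1,0),(0,1)) by replacing (u, v) with (u, u ⊕ v) or (u ⊕ v, v). By 1 each
--    node is a pair of consecutive normals of some W n.
-- 3. Descent (number theory). A pair with a d = 1 + b c is either the root or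
--    the left/right child of a smaller pair with the same determinant; by
--    well-founded induction on a + b + c + d it is therefore a tree node.

open import Defs
open import Data.Integer using (ℤ; +_; _+_; _-_; _*_; _≤_)
open import Data.Nat using (ℕ; suc)
open import Data.Product using (_×_; _,_; Σ)
open import Relation.Binary.PropositionalEquality using (_≡_)

open import Data.Integer using (-[1+_])
import Data.Integer.Properties as ℤ
import Data.Integer.Tactic.RingSolver as ℤ-Solver
import Data.Nat as ℕ
open import Data.Nat using (zero; z≤n; s≤s; _<_; _≤?_)
import Data.Nat.Properties as ℕ
open import Data.Nat.Tactic.RingSolver using (solve-∀)
open import Data.Nat.Induction using (<-wellFounded)
open import Induction.WellFounded using (Acc; acc)
open import Data.List using ([]; _∷_; _++_; [_])
open import Data.List.Properties using (++-assoc)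
open import Data.Product using (∃; ∃₂; proj₁; proj₂)
open import Data.Sum using (inj₁; inj₂)
open import Data.Empty using (⊥; ⊥-elim)
open import Relation.Nullary using (yes; no)
open import Relation.Binary.PropositionalEquality
  using (refl; sym; trans; cong; subst; module ≡-Reasoning)

consecutive-triple : ∀ {L} R x y z T → L ≡ R ++ x ∷ y ∷ z ∷ T →
  CycConsec L x y × CycConsec L y z
consecutive-triple R x y z T eq =
  inj₁ (R , z ∷ T , eq) ,
  inj₁ (R ++ [ x ] , T , trans eq (sym (++-assoc R [ x ] (y ∷ z ∷ T))))

refineFrom-inserts : ∀ f xs u v ys → ∃₂ λ R T →
  refineFrom f (xs ++ u ∷ v ∷ ys) ≡ R ++ u ∷ (u ⊕ v) ∷ v ∷ T
refineFrom-inserts f [] u v [] = [] , (v ⊕ f) ∷ [] , refl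
refineFrom-inserts f [] u v (y ∷ ys) = [] , (v ⊕ y) ∷ refineFrom f (y ∷ ys) , refl
refineFrom-inserts f (x ∷ []) u v ys with refineFrom-inserts f [] u v ys
... | R , T , eq = x ∷ (x ⊕ u) ∷ R , T , cong (λ t → x ∷ (x ⊕ u) ∷ t) eq
refineFrom-inserts f (x ∷ y ∷ xs) u v ys with refineFrom-inserts f (y ∷ xs) u v ys
... | R , T , eq = x ∷ (x ⊕ y) ∷ R , T , cong (λ t → x ∷ (x ⊕ y) ∷ t) eq

refineFrom-wraps : ∀ f x xs u → ∃ λ m →
  refineFrom f (x ∷ (xs ++ [ u ])) ≡ x ∷ (m ++ u ∷ (u ⊕ f) ∷ [])
refineFrom-wraps f x [] u = (x ⊕ u) ∷ [] , refl
refineFrom-wraps f x (y ∷ xs) u with refineFrom-wraps f y xs u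
... | m , eq = (x ⊕ y) ∷ y ∷ m , cong (λ t → x ∷ (x ⊕ y) ∷ t) eq

mediant-insertion : ∀ {L u v} → CycConsec L u v →
  CycConsec (refine L) u (u ⊕ v) × CycConsec (refine L) (u ⊕ v) v
mediant-insertion {u = u} {v} (inj₁ ([] , ys , refl))
  with refineFrom-inserts u [] u v ys
... | R , T , eq = consecutive-triple R u (u ⊕ v) v T eq
mediant-insertion {u = u} {v} (inj₁ (x ∷ xs , ys , refl))
  with refineFrom-inserts x (x ∷ xs) u v ys
... | R , T , eq = consecutive-triple R u (u ⊕ v) v T eq
mediant-insertion {u = u} {v} (inj₂ (m , refl)) with refineFrom-wraps v v m u
... | m′ , eq =
  inj₁ (v ∷ m′ , [] , eq) ,
  inj₂ (m′ ++ [ u ] , trans eq (cong (v ∷_) (sym (++-assoc m′ [ u ] [ u ⊕ v ]))))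

data SternBrocot : ℕ → ℕ → ℕ → ℕ → Set where
  root  : SternBrocot 1 0 0 1
  left  : ∀ {a b c d} → SternBrocot a b c d → SternBrocot a b (a ℕ.+ c) (b ℕ.+ d)
  right : ∀ {a b c d} → SternBrocot a b c d → SternBrocot (a ℕ.+ c) (b ℕ.+ d) c d

node-is-corner : ∀ {a b c d} → SternBrocot a b c d →
  Σ ℕ λ n → CycConsec (W n) (+ a , + b) (+ c , + d)
node-is-corner root = 0 , inj₁ ([] , _ , refl)
node-is-corner (left t) with node-is-corner t
... | n , cc = suc n , proj₁ (mediant-insertion cc)
node-is-corner (right t) with node-is-corner t
... | n , cc = suc n , proj₂ (mediant-insertion cc)

Unimodular : ℕ → ℕ → ℕ → ℕ → Set
Unimodular a b c d = a ℕ.* d ≡ suc (b ℕ.* c)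

unimodular⇒0<a : ∀ a b c d → Unimodular a b c d → 0 < a
unimodular⇒0<a (suc a) _ _ _ _ = s≤s z≤n

unimodular⇒0<d : ∀ a b c d → Unimodular a b c d → 0 < d
unimodular⇒0<d a b c zero u with trans (sym (ℕ.*-zeroʳ a)) u
... | ()
unimodular⇒0<d a b c (suc d) _ = s≤s z≤n

unimodular-leftParent : ∀ a b c d →
  Unimodular a b (a ℕ.+ c) (b ℕ.+ d) → Unimodular a b c d
unimodular-leftParent a b c d u = ℕ.+-cancelˡ-≡ (a ℕ.* b) _ _ (begin
  a ℕ.* b ℕ.+ a ℕ.* d          ≡⟨ expand-lhs a b d ⟩
  a ℕ.* (b ℕ.+ d)              ≡⟨ u ⟩
  suc (b ℕ.* (a ℕ.+ c))        ≡⟨ expand-rhs a b c ⟩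
  a ℕ.* b ℕ.+ suc (b ℕ.* c)    ∎)
  where
  open ≡-Reasoning
  expand-lhs : ∀ a b d → a ℕ.* b ℕ.+ a ℕ.* d ≡ a ℕ.* (b ℕ.+ d)
  expand-lhs = solve-∀
  expand-rhs : ∀ a b c → suc (b ℕ.* (a ℕ.+ c)) ≡ a ℕ.* b ℕ.+ suc (b ℕ.* c)
  expand-rhs = solve-∀

unimodular-rightParent : ∀ a b c d →
  Unimodular (a ℕ.+ c) (b ℕ.+ d) c d → Unimodular a b c d
unimodular-rightParent a b c d u = ℕ.+-cancelˡ-≡ (c ℕ.* d) _ _ (begin
  c ℕ.* d ℕ.+ a ℕ.* d          ≡⟨ expand-lhs a c d ⟩
  (a ℕ.+ c) ℕ.* d              ≡⟨ u ⟩
  suc ((b ℕ.+ d) ℕ.* c)        ≡⟨ expand-rhs b c d ⟩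
  c ℕ.* d ℕ.+ suc (b ℕ.* c)    ∎)
  where
  open ≡-Reasoning
  expand-lhs : ∀ a c d → c ℕ.* d ℕ.+ a ℕ.* d ≡ (a ℕ.+ c) ℕ.* d
  expand-lhs = solve-∀
  expand-rhs : ∀ b c d → suc ((b ℕ.+ d) ℕ.* c) ≡ c ℕ.* d ℕ.+ suc (b ℕ.* c)
  expand-rhs = solve-∀

-- In a unimodular pair the second vector cannot lie weakly below and to the
-- right of the first: a ≤ c and d ≤ b would give a d ≤ b c.
unimodular-not-crossed : ∀ {a b c d} → Unimodular a b c d → a ℕ.≤ c → d ℕ.≤ b → ⊥
unimodular-not-crossed {a} {b} {c} {d} u a≤c d≤b =
  ℕ.<-irrefl refl (begin-strict
    b ℕ.* c   <⟨ ℕ.n<1+n (b ℕ.* c) ⟩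
    suc (b ℕ.* c) ≡⟨ sym u ⟩
    a ℕ.* d   ≤⟨ ℕ.*-mono-≤ a≤c d≤b ⟩
    c ℕ.* b   ≡⟨ ℕ.*-comm c b ⟩
    b ℕ.* c   ∎)
  where open ℕ.≤-Reasoning

product-bound : ∀ b c → suc c ℕ.* suc b ℕ.≤ suc (b ℕ.* c) → b ≡ 0 × c ≡ 0
product-bound b c le with ℕ.+-cancelʳ-≤ (b ℕ.* c) (b ℕ.+ c) 0
                            (ℕ.s≤s⁻¹ (subst (ℕ._≤ suc (b ℕ.* c)) (expand b c) le))
  where
  expand : ∀ b c → suc c ℕ.* suc b ≡ suc (b ℕ.+ c ℕ.+ b ℕ.* c)
  expand = solve-∀
product-bound zero zero _ | z≤n = refl , refl

-- If both coordinates of the first vector strictly dominate those of the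
-- second, then (c+1)(b+1) ≤ a d = 1 + b c, so b = c = 0 and hence a = d = 1.
unimodular-root : ∀ {a b c d} → Unimodular a b c d → c < a → b < d →
  a ≡ 1 × b ≡ 0 × c ≡ 0 × d ≡ 1
unimodular-root {a} {b} {c} {d} u c<a b<d
  with product-bound b c (ℕ.≤-trans (ℕ.*-mono-≤ c<a b<d) (ℕ.≤-reflexive u))
... | refl , refl = ℕ.m*n≡1⇒m≡1 a d u , refl , refl , ℕ.m*n≡1⇒n≡1 a d u

data Descent : ℕ → ℕ → ℕ → ℕ → Set where
  atRoot    : Descent 1 0 0 1
  fromLeft  : ∀ {a b c d} → Unimodular a b c d → Descent a b (a ℕ.+ c) (b ℕ.+ d)
  fromRight : ∀ {a b c d} → Unimodular a b c d → Descent (a ℕ.+ c) (b ℕ.+ d) c d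

difference : ∀ {m n} → m ℕ.≤ n → ∃ λ k → m ℕ.+ k ≡ n
difference m≤n = ℕ.m≤n⇒∃[o]m+o≡n m≤n

difference′ : ∀ {m n} → m ℕ.≤ n → ∃ λ k → k ℕ.+ m ≡ n
difference′ m≤n = _ , ℕ.m∸n+n≡m m≤n

descent : ∀ a b c d → Unimodular a b c d → Descent a b c d
descent a b c d u with a ≤? c
descent a b c d u | yes a≤c with b ≤? d
... | no b≰d = ⊥-elim (unimodular-not-crossed u a≤c (ℕ.<⇒≤ (ℕ.≰⇒> b≰d)))
... | yes b≤d with difference a≤c | difference b≤d
...   | c′ , refl | d′ , refl = fromLeft (unimodular-leftParent a b c′ d′ u)
descent a b c d u | no a≰c with d ≤? b
... | yes d≤b with difference′ (ℕ.<⇒≤ (ℕ.≰⇒> a≰c)) | difference′ d≤b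
...   | a′ , refl | b′ , refl = fromRight (unimodular-rightParent a′ b′ c d u)
descent a b c d u | no a≰c | no d≰b
  with unimodular-root u (ℕ.≰⇒> a≰c) (ℕ.≰⇒> d≰b)
... | refl , refl , refl , refl = atRoot

size : ℕ → ℕ → ℕ → ℕ → ℕ
size a b c d = a ℕ.+ b ℕ.+ (c ℕ.+ d)

size-left : ∀ a b c d → 0 < a ℕ.+ b → size a b c d < size a b (a ℕ.+ c) (b ℕ.+ d)
size-left a b c d pos = subst (size a b c d <_) (regroup a b c d) (ℕ.m<n+m _ pos)
  where
  regroup : ∀ a b c d → a ℕ.+ b ℕ.+ (a ℕ.+ b ℕ.+ (c ℕ.+ d))
                       ≡ a ℕ.+ b ℕ.+ (a ℕ.+ c ℕ.+ (b ℕ.+ d))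
  regroup = solve-∀

size-right : ∀ a b c d → 0 < c ℕ.+ d → size a b c d < size (a ℕ.+ c) (b ℕ.+ d) c d
size-right a b c d pos = subst (size a b c d <_) (regroup a b c d) (ℕ.m<n+m _ pos)
  where
  regroup : ∀ a b c d → c ℕ.+ d ℕ.+ (a ℕ.+ b ℕ.+ (c ℕ.+ d))
                       ≡ a ℕ.+ c ℕ.+ (b ℕ.+ d) ℕ.+ (c ℕ.+ d)
  regroup = solve-∀

unimodular⇒node : ∀ a b c d → Unimodular a b c d → SternBrocot a b c d
unimodular⇒node a b c d u = go a b c d u (<-wellFounded (size a b c d))
  where
  go : ∀ a b c d → Unimodular a b c d → Acc _<_ (size a b c d) → SternBrocot a b c d
  go a b c d u (acc smaller) with descent a b c d u
  ... | atRoot = root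
  ... | fromLeft {c = c′} {d = d′} u′ =
    left (go a b c′ d′ u′ (smaller (size-left a b c′ d′
      (ℕ.≤-trans (unimodular⇒0<a a b c′ d′ u′) (ℕ.m≤m+n a b)))))
  ... | fromRight {a = a′} {b = b′} u′ =
    right (go a′ b′ c d u′ (smaller (size-right a′ b′ c d
      (ℕ.≤-trans (unimodular⇒0<d a′ b′ c d u′) (ℕ.m≤n+m d c)))))

integer-unimodular : ∀ a b c d → + a * + d - + b * + c ≡ + 1 → Unimodular a b c d
integer-unimodular a b c d det = ℤ.+-injective (begin
  + (a ℕ.* d)                    ≡⟨ ℤ.pos-* a d ⟩
  + a * + d                      ≡⟨ sub-add (+ a * + d) (+ b * + c) ⟩
  (+ a * + d - + b * + c) + + b * + c ≡⟨ cong (_+ + b * + c) det ⟩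
  + 1 + + b * + c                ≡⟨ cong (λ t → + 1 + t) (sym (ℤ.pos-* b c)) ⟩
  + suc (b ℕ.* c)                ∎)
  where
  open ≡-Reasoning
  sub-add : ∀ (x y : ℤ) → x ≡ (x - y) + y
  sub-add = ℤ-Solver.solve-∀

mainTheorem3 : (a b c d : ℤ) → + 0 ≤ a → + 0 ≤ b → + 0 ≤ c → + 0 ≤ d →
    a * d - b * c ≡ + 1 →
    Σ ℕ (λ n → Corner (W n) (a , b) (c , d)
      × Corner (W (suc n)) (a , b) (a + c , b + d)
      × Corner (W (suc n)) (a + c , b + d) (c , d))
mainTheorem3 (+ a) (+ b) (+ c) (+ d) _ _ _ _ det
  with node-is-corner (unimodular⇒node a b c d (integer-unimodular a b c d det))
... | n , corner =
  n , inj₁ corner , inj₁ (proj₁ (mediant-insertion corner))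
                  , inj₁ (proj₂ (mediant-insertion corner))
mainTheorem3 -[1+ _ ] _ _ _ () _ _ _ _
mainTheorem3 (+ _) -[1+ _ ] _ _ _ () _ _ _
mainTheorem3 (+ _) (+ _) -[1+ _ ] _ _ _ () _ _
mainTheorem3 (+ _) (+ _) (+ _) -[1+ _ ] _ _ _ () _
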